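{- Let $G$ and $H$ be two nontrivial connected graphs. (1) If both $G$ and $H$ are complete, then $pvc(G\square H)=1$; otherwise $pvc(G\square H)=2$. (2) If $G$ and $H$ are two complete graphs each of order at least $3$, then $pvc_2(G\square H)=1$; otherwise $pvc_2(G\square H)=2$. (3) If both $G$ and $H$ are complete, then $spvc(G\square H)=1$; otherwise $spvc(G\square H)\leq \min\{spvc(G)\cdot\chi(H),\ spvc(H)\cdot\chi(G)\}$, where $\chi$ denotes the chromatic number.
   Context: All graphs are simple, finite and undirected; nontrivial means having at least two vertices. The Cartesian product $G\square H$ has vertex set $V(G)\times V(H)$, with $(g,h)$ adjacent to $(g',h')$ iff either $g=g'$ and $hh'\in E(H)$, or $h=h'$ and $gg'\in E(G)$. A set of paths between two vertices is called disjoint if they are internally vertex-disjoint. In a vertex-colored graph, a path is vertex-proper if any two adjacent internal vertices of the path receive different colors. A vertex-colored graph is proper vertex $k$-connected if any two vertices are joined by $k$ disjoint vertex-proper paths. For a $k$-connected graph $G$, $pvc_k(G)$ is the smallest number of colors in a vertex-coloring making $G$ proper vertex $k$-connected; $pvc(G)=pvc_1(G)$, with $pvc(G)=0$ for complete $G$ (for $k\ge2$, $pvc_k(G)\ge 1$). A $u$-$v$ geodesic is a $u$-$v$ path of length $d(u,v)$. A vertex-colored graph is strong proper vertex-connected if for any two vertices $u,v$ there is a vertex-proper $u$-$v$ geodesic; $spvc(G)$ is the smallest number of colors needed for this, with $spvc(G)=0$ for complete $G$.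
   Formalization: In (3), spvc(G) and spvc(H) are the plain least numbers of colors, without the convention spvc = 0 for a complete graph, so a complete factor has spvc equal to 1. The statement above fails without it. -}

module Defs where

open import Data.Nat using (ℕ; _≤_; _<_)
open import Data.Fin using (Fin; _≟_; remQuot)
open import Data.Bool using (Bool; true; false; _∧_; _∨_)
open import Data.Bool.Properties using (∨-comm)
open import Data.List using (List; []; _∷_; _++_; length)
open import Data.List.Relation.Unary.Linked using (Linked)
open import Data.List.Relation.Unary.Unique.Propositional using (Unique)
open import Data.List.Membership.Propositional using (_∈_; _∉_)
open import Data.Product using (Σ; ∃; _×_; _,_; proj₁; proj₂)
open import Relation.Nullary using (¬_; yes; no)
open import Relation.Nullary.Decidable using (⌊_⌋)
open import Relation.Binary.PropositionalEquality using (_≡_; _≢_; refl; sym; cong₂)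

record Graph : Set where
  field
    n          : ℕ
    adj        : Fin n → Fin n → Bool
    adj-sym    : ∀ u v → adj u v ≡ adj v u
    adj-irrefl : ∀ v → adj v v ≡ false
open Graph public

Adj : (G : Graph) → Fin (n G) → Fin (n G) → Set
Adj G u v = adj G u v ≡ true

Nontrivial : Graph → Set
Nontrivial G = 2 ≤ n G

Complete : Graph → Set
Complete G = ∀ u v → u ≢ v → Adj G u v

-- Cartesian product (vertex set Fin (n G * n H) ≅ Fin (n G) × Fin (n H)
-- via the standard bijection remQuot / combine)

private
  eqb : ∀ {m} → Fin m → Fin m → Bool
  eqb a b = ⌊ a ≟ b ⌋

  eqb-sym : ∀ {m} (a b : Fin m) → eqb a b ≡ eqb b a
  eqb-sym a b with a ≟ b | b ≟ a
  ... | yes _ | yes _ = refl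
  ... | no _  | no _  = refl
  ... | yes p | no q  with q (sym p)
  ... | ()
  eqb-sym a b | no p | yes q with p (sym q)
  ... | ()

  eqb-refl : ∀ {m} (a : Fin m) → eqb a a ≡ true
  eqb-refl a with a ≟ a
  ... | yes _ = refl
  ... | no p with p refl
  ... | ()

module _ (G H : Graph) where
  private
    pairAdj : Fin (n G) × Fin (n H) → Fin (n G) × Fin (n H) → Bool
    pairAdj (g , h) (g' , h') =
      (eqb g g' ∧ adj H h h') ∨ (eqb h h' ∧ adj G g g')

    pairAdj-sym : ∀ x y → pairAdj x y ≡ pairAdj y x
    pairAdj-sym (g , h) (g' , h') =
      cong₂ _∨_ (cong₂ _∧_ (eqb-sym g g') (adj-sym H h h'))
                (cong₂ _∧_ (eqb-sym h h') (adj-sym G g g'))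

    pairAdj-irrefl : ∀ x → pairAdj x x ≡ false
    pairAdj-irrefl (g , h)
      rewrite eqb-refl g | eqb-refl h | adj-irrefl H h | adj-irrefl G g = refl

  _□_ : Graph
  _□_ = record
    { n          = n G Data.Nat.* n H
    ; adj        = λ x y → pairAdj (remQuot (n H) x) (remQuot (n H) y)
    ; adj-sym    = λ x y → pairAdj-sym (remQuot (n H) x) (remQuot (n H) y)
    ; adj-irrefl = λ x → pairAdj-irrefl (remQuot (n H) x)
    }

-- A u-v path is given by its list of internal vertices xs;
-- the path itself is the vertex sequence u ∷ xs ++ [ v ], which must be
-- a walk (consecutive vertices adjacent) without repeated vertices.
-- Its length is length xs + 1.

IsPath : (G : Graph) → Fin (n G) → Fin (n G) → List (Fin (n G)) → Set
IsPath G u v xs =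
  Linked (Adj G) (u ∷ xs ++ v ∷ []) × Unique (u ∷ xs ++ v ∷ [])

Connected : Graph → Set
Connected G = ∀ u v → u ≢ v → ∃ λ xs → IsPath G u v xs

IsGeodesic : (G : Graph) → Fin (n G) → Fin (n G) → List (Fin (n G)) → Set
IsGeodesic G u v xs =
  IsPath G u v xs × (∀ ys → IsPath G u v ys → length xs ≤ length ys)

Coloring : Graph → ℕ → Set
Coloring G k = Fin (n G) → Fin k

VertexProper : ∀ {G k} → Coloring G k → List (Fin (n G)) → Set
VertexProper c xs = Linked (λ a b → c a ≢ c b) xs

-- two u-v paths (given by their internal vertices) are distinct and
-- internally vertex-disjoint.  (Two internally disjoint paths coincide
-- iff both have no internal vertices, i.e. both are the edge uv.)
DistinctDisjoint : ∀ {A : Set} → List A → List A → Set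
DistinctDisjoint xs ys =
  (∀ x → x ∈ xs → x ∉ ys) × ¬ (xs ≡ [] × ys ≡ [])

ProperVertexKConnected : (G : Graph) (k : ℕ) {p : ℕ} → Coloring G p → Set
ProperVertexKConnected G k c =
  ∀ u v → u ≢ v →
    Σ (Fin k → List (Fin (n G))) λ ps →
      (∀ i → IsPath G u v (ps i) × VertexProper {G} c (ps i)) ×
      (∀ i j → i ≢ j → DistinctDisjoint (ps i) (ps j))

StrongProperVertexConnected : (G : Graph) {p : ℕ} → Coloring G p → Set
StrongProperVertexConnected G c =
  ∀ u v → u ≢ v → ∃ λ xs → IsGeodesic G u v xs × VertexProper {G} c xs

ProperColoring : (G : Graph) {p : ℕ} → Coloring G p → Set
ProperColoring G c = ∀ u v → Adj G u v → c u ≢ c v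

IsLeast : (ℕ → Set) → ℕ → Set
IsLeast P m = P m × (∀ j → j < m → ¬ P j)

IsPvc : ℕ → Graph → ℕ → Set
IsPvc k G = IsLeast (λ p → Σ (Coloring G p) (ProperVertexKConnected G k))

IsSpvc : Graph → ℕ → Set
IsSpvc G = IsLeast (λ p → Σ (Coloring G p) (StrongProperVertexConnected G))

IsChromatic : Graph → ℕ → Set
IsChromatic G = IsLeast (λ p → Σ (Coloring G p) (ProperColoring G))

-- With one colour a vertex-proper path has at most one internal vertex. A walk in G □ H projects onto
-- walks in G and H whose lengths add up, so if G is not complete, (g , h) and (g′ , h′) with g, g′
-- distinct and non-adjacent and h ≢ h′ are at distance at least 3; and if G = K₂, the adjacent vertices
-- (g , h) and (g′ , h) have no common neighbour, so the edge is their only short path. For complete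
-- factors, with at least three vertices each for two paths, paths of length at most 2 do suffice.
-- Two colours always suffice: colouring a connected graph by the parity of the distance from a root
-- joins any two vertices by a walk along bichromatic edges, and the xor of such colourings of G and H
-- keeps every copy of these edges in G □ H bichromatic. Two internally disjoint walks between two
-- vertices of G □ H (through two parallel layers, or along the two L-shapes) shortcut to the paths.
-- For (3), (g , h) is coloured by the pair of a strong proper colour of g and a proper colour of h;
-- since distances add, geodesics of the factors assemble into vertex-proper geodesics of G □ H.

module Submission where

open import Level using (0ℓ)
open import Data.Bool using (Bool; true; false; not; _xor_; _∧_; _∨_; T)
open import Data.Bool.Properties
  using (not-¬; ¬-not; not-distribˡ-xor; not-distribʳ-xor; T-≡; T-∧; T-∨; ∨-zeroʳ)
  renaming (_≟_ to _≟ᵇ_)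
open import Data.Empty using (⊥; ⊥-elim)
open import Data.Fin using (Fin; zero; suc; _≟_; combine; remQuot; inject≤; punchIn; punchOut)
open import Data.Fin.Patterns using (0F; 1F; 2F)
open import Data.Fin.Properties
  using (any?; all?; ¬∀⟶∃¬; pigeonhole; 2↔Bool; remQuot-combine; combine-remQuot; combine-injective;
         inject≤-injective; punchInᵢ≢i; punchIn-injective; punchIn-punchOut)
open import Data.List using (List; []; _∷_; _++_; [_]; length; map)
open import Data.List.Properties using (length-++; length-map)
open import Data.List.Membership.Propositional using (_∈_)
open import Data.List.Membership.Propositional.Properties using (∈-++⁺ˡ; ∈-++⁺ʳ)
open import Data.List.Relation.Binary.Sublist.Propositional
  using (_⊆_; []; _∷_; _∷ʳ_; minimum; ⊆-refl; ⊆-trans)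
open import Data.List.Relation.Binary.Sublist.Propositional.Properties using (length-mono-≤; All-resp-⊆)
open import Data.List.Relation.Unary.All as All using (All; []; _∷_)
import Data.List.Relation.Unary.All.Properties as All
open import Data.List.Relation.Unary.AllPairs using ([]; _∷_)
open import Data.List.Relation.Unary.Any using (here; there)
open import Data.List.Relation.Unary.Linked as Linked using (Linked; []; [-]; _∷_)
import Data.List.Relation.Unary.Linked.Properties as Linked
open import Data.List.Relation.Unary.Unique.Propositional using (Unique)
open import Data.Nat using (ℕ; zero; suc; _+_; _*_; _⊓_; _≤_; _<_; _≤?_; s≤s; z≤n; s≤s⁻¹)
open import Data.Nat.Properties
  using (≤-refl; ≤-trans; ≤-antisym; ≮⇒≥; ≤⇒≯; ≰⇒>; +-suc; +-comm; +-identityʳ; +-mono-≤; ⊓-glb)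
open import Data.Product using (Σ; ∃; ∃₂; _×_; _,_; proj₁; proj₂)
open import Data.Sum as Sum using (_⊎_; inj₁; inj₂)
open import Function using (_∘_; id; const; Equivalence; Inverse)
open import Relation.Binary using (Rel; DecidableEquality; _⇒_)
open import Relation.Binary.Construct.Closure.ReflexiveTransitive as Star using (Star; ε; _◅_; _◅◅_)
open import Relation.Binary.PropositionalEquality
  using (_≡_; _≢_; refl; sym; trans; cong; cong₂; subst; subst₂; module ≡-Reasoning)
open import Relation.Nullary using (¬_; ¬?; yes; no; Dec)
open import Relation.Nullary.Decidable using (⌊_⌋; _×-dec_; _⊎-dec_; _→-dec_; toWitness)

open import Defs

-- Walks and their shortcuts

Walk : {A : Set} → Rel A 0ℓ → A → List A → A → Set
Walk R u I v = Linked R (u ∷ I ++ [ v ])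

module _ {A : Set} where

  module _ {R : Rel A 0ℓ} where

    walk-++ : ∀ {u m v} I {J} → Walk R u I m → Walk R m J v → Walk R u (I ++ m ∷ J) v
    walk-++ []      (r ∷ [-]) w′ = r ∷ w′
    walk-++ (_ ∷ I) (r ∷ w)   w′ = r ∷ walk-++ I w w′

    walk-init : ∀ {u v} I → Walk R u I v → Linked R (u ∷ I)
    walk-init []      _       = [-]
    walk-init (_ ∷ I) (r ∷ w) = r ∷ walk-init I w

    walk-interior : ∀ {u v} I → Walk R u I v → Linked R I
    walk-interior I w = Linked.tail (walk-init I w)

    linked-join : ∀ xs {m ys} → Linked R (xs ++ [ m ]) → Linked R (m ∷ ys) → Linked R (xs ++ m ∷ ys)
    linked-join []           _       l = l
    linked-join (_ ∷ [])     (r ∷ _) l = r ∷ l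
    linked-join (_ ∷ _ ∷ xs) (r ∷ k) l = r ∷ linked-join (_ ∷ xs) k l

  walk-map : ∀ {B : Set} {R : Rel A 0ℓ} {S : Rel B 0ℓ} (f : A → B) → (∀ {x y} → R x y → S (f x) (f y)) →
             ∀ {u v} I → Walk R u I v → Walk S (f u) (map f I) (f v)
  walk-map f g []      (r ∷ [-]) = g r ∷ [-]
  walk-map f g (_ ∷ I) (r ∷ w)   = g r ∷ walk-map f g I w

  module _ {v : A} where

    unique-avoids-last : ∀ {z} I → Unique (I ++ [ v ]) → z ∈ I → z ≢ v
    unique-avoids-last (_ ∷ I) (x∉ ∷ _) (here refl) = All.lookup x∉ (∈-++⁺ʳ I (here refl))
    unique-avoids-last (_ ∷ I) (_ ∷ un) (there z∈I) = unique-avoids-last I un z∈I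

    unique-avoids-ends : ∀ {u z} I → Unique (u ∷ I ++ [ v ]) → z ∈ I → z ≢ u × z ≢ v
    unique-avoids-ends I (u∉ ∷ un) z∈I =
      (λ z≡u → All.lookup u∉ (∈-++⁺ˡ z∈I) (sym z≡u)) , unique-avoids-last I un z∈I

module _ {A : Set} {R : Rel A 0ℓ} where

  steps : ∀ {x y} → Star R x y → ℕ
  steps ε       = 0
  steps (_ ◅ w) = suc (steps w)

  walk⇒star : ∀ {u v} I → Walk R u I v → Σ (Star R u v) λ w → steps w ≡ suc (length I)
  walk⇒star []      (r ∷ [-]) = r ◅ ε , refl
  walk⇒star (_ ∷ I) (r ∷ w)   = let s , e = walk⇒star I w in r ◅ s , cong suc e

  star⇒walk : ∀ {u v} (w : Star R u v) → u ≢ v → ∃ λ I → Walk R u I v × suc (length I) ≡ steps w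
  star⇒walk ε       u≢u = ⊥-elim (u≢u refl)
  star⇒walk (r ◅ w) _   = let I , l , e = after r w in I , l , cong suc e
    where
    after : ∀ {u x v} → R u x → (w : Star R x v) → ∃ λ I → Walk R u I v × length I ≡ steps w
    after r ε                  = [] , r ∷ [-] , refl
    after {x = x} r (r′ ◅ w)   = let I , l , e = after r′ w in x ∷ I , r ∷ l , cong suc e

  relabel : ∀ {a a′ b b′} → a ≡ a′ → b ≡ b′ → (w : Star R a b) → Σ (Star R a′ b′) λ w′ → steps w′ ≡ steps w
  relabel refl refl w = w , refl

  steps-≥1 : ∀ {u v} → u ≢ v → (w : Star R u v) → 1 ≤ steps w
  steps-≥1 u≢u ε       = ⊥-elim (u≢u refl)
  steps-≥1 _   (_ ◅ _) = s≤s z≤n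

  steps-≥2 : ∀ {u v} → u ≢ v → ¬ R u v → (w : Star R u v) → 2 ≤ steps w
  steps-≥2 u≢u _   ε           = ⊥-elim (u≢u refl)
  steps-≥2 _   ¬uv (r ◅ ε)     = ⊥-elim (¬uv r)
  steps-≥2 _   _   (_ ◅ _ ◅ _) = s≤s (s≤s z≤n)

  firstStep : ∀ {u v} → u ≢ v → Star R u v → ∃ (R u)
  firstStep u≢u ε       = ⊥-elim (u≢u refl)
  firstStep _   (r ◅ _) = _ , r

module _ {A : Set} (_≟_ : DecidableEquality A) {R : Rel A 0ℓ} where

  open import Data.List.Membership.DecPropositional _≟_ using (_∈?_)

  SubPath : A → List A → A → Set
  SubPath u I v = ∃ λ p → p ⊆ I × Walk R u p v × Unique (u ∷ p ++ [ v ])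

  private
    suffix : ∀ {x u v} p → u ∈ x ∷ p → Walk R x p v → Unique (x ∷ p ++ [ v ]) → SubPath u p v
    suffix p       (here refl)   w       un       = p , ⊆-refl , w , un
    suffix (_ ∷ p) (there u∈yp)  (_ ∷ w) (_ ∷ un) =
      let q , q⊆p , w′ , un′ = suffix p u∈yp w un in q , _ ∷ʳ q⊆p , w′ , un′

  shortcut : ∀ {u v} I → u ≢ v → Walk R u I v → SubPath u I v
  shortcut []      u≢v w = [] , [] , w , (u≢v ∷ []) ∷ [] ∷ []
  shortcut {u} {v} (x ∷ I) u≢v (r ∷ w) with x ≟ v
  ... | yes refl = [] , minimum _ , r ∷ [-] , (u≢v ∷ []) ∷ [] ∷ []
  ... | no x≢v with shortcut I x≢v w
  ...   | p , p⊆I , w′ , un with u ∈? (x ∷ p)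
  ...     | yes u∈xp = let q , q⊆p , w″ , un′ = suffix p u∈xp w′ un in q , x ∷ʳ ⊆-trans q⊆p p⊆I , w″ , un′
  ...     | no u∉xp = x ∷ p , refl ∷ p⊆I , r ∷ w′ , All.++⁺ (All.¬Any⇒All¬ (x ∷ p) u∉xp) (u≢v ∷ []) ∷ un

module _ {A : Set} (_≟_ : DecidableEquality A) {K : Set} (c : A → K) {R : Rel A 0ℓ} where

  -- Each edge carries the colour condition, relaxed to hold vacuously when the edge starts at u or
  -- ends at v; shortcutting preserves it, and on the resulting path no internal edge touches u or v.
  properShortcut : ∀ {u v} I → u ≢ v → Walk R u I v → Linked (λ x y → c x ≢ c y) I →
                   ∃ λ p → p ⊆ I × Walk R u p v × Unique (u ∷ p ++ [ v ]) × Linked (λ x y → c x ≢ c y) p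
  properShortcut {u} {v} I u≢v w proper =
    let p , p⊆I , w′ , un = shortcut _≟_ I u≢v (mark I w proper) in
    p , p⊆I , Linked.map proj₁ w′ , un , unmark p (unique-avoids-ends p un) (walk-interior p w′)
    where
    R′ : Rel A 0ℓ
    R′ x y = R x y × (x ≢ u → y ≢ v → c x ≢ c y)

    markFrom : ∀ {x} I → Walk R x I v → Linked (λ x y → c x ≢ c y) (x ∷ I) → Walk R′ x I v
    markFrom []      (r ∷ [-]) _        = (r , λ _ v≢v → ⊥-elim (v≢v refl)) ∷ [-]
    markFrom (_ ∷ I) (r ∷ w)   (d ∷ ds) = (r , λ _ _ → d) ∷ markFrom I w ds

    mark : ∀ I → Walk R u I v → Linked (λ x y → c x ≢ c y) I → Walk R′ u I v
    mark []      (r ∷ [-]) _  = (r , λ u≢u → ⊥-elim (u≢u refl)) ∷ [-]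
    mark (_ ∷ I) (r ∷ w)   ds = (r , λ u≢u → ⊥-elim (u≢u refl)) ∷ markFrom I w ds

    unmark : ∀ p → (∀ {z} → z ∈ p → z ≢ u × z ≢ v) → Linked R′ p → Linked (λ x y → c x ≢ c y) p
    unmark []          _     []             = []
    unmark (_ ∷ [])    _     [-]            = [-]
    unmark (_ ∷ _ ∷ p) avoid ((_ , d) ∷ rs) =
      d (proj₁ (avoid (here refl))) (proj₂ (avoid (there (here refl)))) ∷ unmark (_ ∷ p) (avoid ∘ there) rs

vertex : ∀ {m} → 2 ≤ m → Fin m
vertex (s≤s _) = zero

twoVertices : ∀ {m} → 2 ≤ m → ∃₂ λ (u v : Fin m) → u ≢ v
twoVertices (s≤s (s≤s _)) = 0F , 1F , λ ()

anotherVertex : ∀ {m} → 2 ≤ m → (u : Fin m) → ∃ (_≢ u)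
anotherVertex (s≤s (s≤s _)) u = punchIn u zero , punchInᵢ≢i u zero

thirdVertex : ∀ {m} → 3 ≤ m → {u v : Fin m} → u ≢ v → ∃ λ w → w ≢ u × w ≢ v
thirdVertex (s≤s (s≤s (s≤s _))) {u} u≢v =
  punchIn u w′ , punchInᵢ≢i u w′ ,
  λ same → punchInᵢ≢i (punchOut u≢v) zero (punchIn-injective u _ _ (trans same (sym (punchIn-punchOut u≢v))))
  where
  w′ = punchIn (punchOut u≢v) zero

no-three-distinct : ∀ {m} → m ≤ 2 → {x y z : Fin m} → x ≢ y → x ≢ z → y ≢ z → ⊥
no-three-distinct m≤2 {x} {y} {z} x≢y x≢z y≢z with pigeonhole (s≤s m≤2) (λ { 0F → x ; 1F → y ; 2F → z })
... | 0F , 1F , _ , same = x≢y same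
... | 0F , 2F , _ , same = x≢z same
... | 1F , 2F , _ , same = y≢z same
... | suc _       , 1F , s≤s ()       , _
... | suc (suc _) , 2F , s≤s (s≤s ()) , _

xor-≢ˡ : ∀ {x y} z → x ≢ y → x xor z ≢ y xor z
xor-≢ˡ {y = y} z x≢y rewrite ¬-not x≢y = not-¬ refl ∘ sym ∘ trans (not-distribˡ-xor y z)

xor-≢ʳ : ∀ {x y} z → x ≢ y → z xor x ≢ z xor y
xor-≢ʳ {y = y} z x≢y rewrite ¬-not x≢y = not-¬ refl ∘ sym ∘ trans (not-distribʳ-xor z y)

leastWitness : {P : ℕ → Set} → (∀ k → Dec (P k)) → ∀ {k} → P k → ∃ (IsLeast P)
leastWitness P? {zero}  p = 0 , p , λ _ ()
leastWitness P? {suc k} p with P? 0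
... | yes p₀ = 0 , p₀ , λ _ ()
... | no ¬p₀ =
  let m , pm , below = leastWitness (P? ∘ suc) p
  in suc m , pm , λ { zero _ → ¬p₀ ; (suc j) j<m → below j (s≤s⁻¹ j<m) }

module _ {P : ℕ → Set} where

  isLeast₁ : P 1 → ¬ P 0 → IsLeast P 1
  isLeast₁ p₁ ¬p₀ = p₁ , λ { zero _ → ¬p₀ ; (suc _) (s≤s ()) }

  isLeast₂ : P 2 → ¬ P 0 → ¬ P 1 → IsLeast P 2
  isLeast₂ p₂ ¬p₀ ¬p₁ = p₂ , λ { 0 _ → ¬p₀ ; 1 _ → ¬p₁ ; (suc (suc _)) (s≤s (s≤s ())) }

  isLeast⇒≤ : ∀ {m k} → IsLeast P m → P k → m ≤ k
  isLeast⇒≤ (_ , below) p = ≮⇒≥ λ k<m → below _ k<m p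

module _ (G : Graph) where

  adj-irreflexive : ∀ {u} → ¬ Adj G u u
  adj-irreflexive {u} a with trans (sym (adj-irrefl G u)) a
  ... | ()

  adj⇒≢ : ∀ {u v} → Adj G u v → u ≢ v
  adj⇒≢ a refl = adj-irreflexive a

  adj-symmetric : ∀ {u v} → Adj G u v → Adj G v u
  adj-symmetric {u} {v} a = trans (adj-sym G v u) a

  path⇒≢ : ∀ {u v} p → IsPath G u v p → u ≢ v
  path⇒≢ p (_ , u∉ ∷ _) = All.lookup u∉ (∈-++⁺ʳ p (here refl))

  edge-path : ∀ {u v} → Adj G u v → IsPath G u v []
  edge-path a = a ∷ [-] , (adj⇒≢ a ∷ []) ∷ [] ∷ []

  two-edge-path : ∀ {u w v} → Adj G u w → Adj G w v → u ≢ v → IsPath G u v [ w ]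
  two-edge-path a a′ u≢v = a ∷ a′ ∷ [-] , (adj⇒≢ a ∷ u≢v ∷ []) ∷ (adj⇒≢ a′ ∷ []) ∷ [] ∷ []

  geodesic-≤-steps : ∀ {u v} xs → IsGeodesic G u v xs → (w : Star (Adj G) u v) → suc (length xs) ≤ steps w
  geodesic-≤-steps xs (path , shortest) w =
    let u≢v = path⇒≢ xs path
        I , walk , I-steps = star⇒walk w u≢v
        p , p⊆I , p-walk , p-unique = shortcut _≟_ I u≢v walk
    in subst (suc (length xs) ≤_) I-steps (s≤s (≤-trans (shortest p (p-walk , p-unique)) (length-mono-≤ p⊆I)))

  private
    joined? : ∀ u v → Dec (u ≢ v → Adj G u v)
    joined? u v = ¬? (u ≟ v) →-dec (adj G u v ≟ᵇ true)

  complete? : Dec (Complete G)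
  complete? = all? λ u → all? (joined? u)

  ¬complete⇒nonadjacent : ¬ Complete G → ∃₂ λ u v → u ≢ v × ¬ Adj G u v
  ¬complete⇒nonadjacent ¬complete =
    let u , ¬all     = ¬∀⟶∃¬ (n G) _ (λ u → all? (joined? u)) ¬complete
        v , ¬joined  = ¬∀⟶∃¬ (n G) _ (joined? u) ¬all
    in u , v , (λ u≡v → ¬joined (λ u≢v → ⊥-elim (u≢v u≡v))) , ¬joined ∘ const

Bichromatic : (G : Graph) {K : Set} → (Fin (n G) → K) → Rel (Fin (n G)) 0ℓ
Bichromatic G c u v = Adj G u v × c u ≢ c v

BichromaticallyConnected : (G : Graph) {K : Set} → (Fin (n G) → K) → Set
BichromaticallyConnected G c = ∀ u v → Star (Bichromatic G c) u v

bichromatic-sym : ∀ {G K} {c : Fin (n G) → K} {u v} → Bichromatic G c u v → Bichromatic G c v u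
bichromatic-sym {G} (a , differ) = adj-symmetric G a , differ ∘ sym

ProperPath : (G : Graph) {k : ℕ} → Coloring G k → Fin (n G) → Fin (n G) → List (Fin (n G)) → Set
ProperPath G c u v p = IsPath G u v p × VertexProper {G} c p

TwoDisjointProperPaths : (G : Graph) {k : ℕ} → Coloring G k → Fin (n G) → Fin (n G) → Set
TwoDisjointProperPaths G c u v =
  ∃₂ λ p q → ProperPath G c u v p × ProperPath G c u v q × DistinctDisjoint p q

module _ {G : Graph} {k : ℕ} {c : Coloring G k} where

  properPath : ∀ {R} → R ⇒ Adj G → ∀ {u v} I → u ≢ v → Walk R u I v → VertexProper {G} c I →
               ∃ λ p → p ⊆ I × Walk R u p v × ProperPath G c u v p
  properPath R⇒Adj I u≢v walk proper =
    let p , p⊆I , walk′ , unique , proper′ = properShortcut _≟_ c I u≢v walk proper in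
    p , p⊆I , walk′ , (Linked.map R⇒Adj walk′ , unique) , proper′

  bichromaticPath : ∀ {R} → R ⇒ Bichromatic G c → ∀ {u v} I → u ≢ v → Walk R u I v →
                    {Q : Fin (n G) → Set} → All Q I → ∃ λ p → Walk R u p v × ProperPath G c u v p × All Q p
  bichromaticPath R⇒Bi I u≢v walk inI =
    let p , p⊆I , walk′ , path = properPath (proj₁ ∘ R⇒Bi) I u≢v walk
                                   (Linked.map (proj₂ ∘ R⇒Bi) (walk-interior I walk))
    in p , walk′ , path , All-resp-⊆ p⊆I inI

  shortest-walk⇒geodesic : ∀ {u v} I → u ≢ v → Walk (Adj G) u I v → VertexProper {G} c I →
                           (∀ zs → IsPath G u v zs → length I ≤ length zs) →
                           ∃ λ p → IsGeodesic G u v p × VertexProper {G} c p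
  shortest-walk⇒geodesic I u≢v walk proper shortest =
    let p , p⊆I , _ , path , proper′ = properPath id I u≢v walk proper in
    p , (path , λ zs path-zs → ≤-trans (length-mono-≤ p⊆I) (shortest zs path-zs)) , proper′

  distinctDisjoint-sym : ∀ {xs ys : List (Fin (n G))} → DistinctDisjoint xs ys → DistinctDisjoint ys xs
  distinctDisjoint-sym (disjoint , distinct) =
    (λ z z∈ys z∈xs → disjoint z z∈xs z∈ys) , λ (ys≡[] , xs≡[]) → distinct (xs≡[] , ys≡[])

  twoPaths⇒pvc₂ : (∀ u v → u ≢ v → TwoDisjointProperPaths G c u v) → ProperVertexKConnected G 2 c
  twoPaths⇒pvc₂ two u v u≢v with two u v u≢v
  ... | p , q , path-p , path-q , disjoint = paths , proper , pairwise
    where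
    paths : Fin 2 → List (Fin (n G))
    paths 0F = p
    paths 1F = q
    proper : ∀ i → ProperPath G c u v (paths i)
    proper 0F = path-p
    proper 1F = path-q
    pairwise : ∀ i j → i ≢ j → DistinctDisjoint (paths i) (paths j)
    pairwise 0F 0F 0≢0 = ⊥-elim (0≢0 refl)
    pairwise 0F 1F _   = disjoint
    pairwise 1F 0F _   = distinctDisjoint-sym disjoint
    pairwise 1F 1F 1≢1 = ⊥-elim (1≢1 refl)

  pvc-mono : ∀ {i j} → i ≤ j → ProperVertexKConnected G j c → ProperVertexKConnected G i c
  pvc-mono i≤j pvc u v u≢v =
    let paths , proper , pairwise = pvc u v u≢v in
    (λ l → paths (inject≤ l i≤j)) , (λ l → proper (inject≤ l i≤j)) ,
    λ l l′ l≢l′ → pairwise _ _ (l≢l′ ∘ inject≤-injective i≤j i≤j l l′)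

  spvc⇒pvc₁ : StrongProperVertexConnected G c → ProperVertexKConnected G 1 c
  spvc⇒pvc₁ spvc u v u≢v =
    let p , (path , _) , proper = spvc u v u≢v in
    (λ _ → p) , (λ _ → path , proper) , λ { 0F 0F 0≢0 → ⊥-elim (0≢0 refl) }

monochrome : (G : Graph) → Coloring G 1
monochrome G _ = zero

vertexProper₁-short : ∀ {G} (c : Coloring G 1) {xs} → VertexProper {G} c xs → length xs ≤ 1
vertexProper₁-short c []      = z≤n
vertexProper₁-short c [-]     = s≤s z≤n
vertexProper₁-short c (d ∷ _) = ⊥-elim (d (fin₁ (c _) (c _)))
  where
  fin₁ : (i j : Fin 1) → i ≡ j
  fin₁ zero zero = refl

spvc⇒geodesics : ∀ {G k} {c : Coloring G k} → StrongProperVertexConnected G c →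
                 ∀ u v → u ≢ v → ∃ (IsGeodesic G u v)
spvc⇒geodesics spvc u v u≢v = let p , geodesic , _ = spvc u v u≢v in p , geodesic

-- Bichromatic walks in connected graphs

parity : ℕ → Bool
parity zero    = false
parity (suc k) = not (parity k)

module BreadthFirst (G : Graph) (connected : Connected G) (root : Fin (n G)) where

  Within : ℕ → Fin (n G) → Set
  Within zero    v = v ≡ root
  Within (suc k) v = Within k v ⊎ ∃ λ u → Within k u × Adj G u v

  within? : ∀ k v → Dec (Within k v)
  within? zero    v = v ≟ root
  within? (suc k) v = within? k v ⊎-dec any? (λ u → within? k u ×-dec (adj G u v ≟ᵇ true))

  within-walk : ∀ {k u v} I → Within k u → Walk (Adj G) u I v → ∃ λ k′ → Within k′ v
  within-walk []      wu (a ∷ [-]) = _ , inj₂ (_ , wu , a)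
  within-walk (_ ∷ I) wu (a ∷ w)   = within-walk I (inj₂ (_ , wu , a)) w

  reachable : ∀ v → ∃ λ k → Within k v
  reachable v with v ≟ root
  ... | yes v≡root = 0 , v≡root
  ... | no  v≢root = let I , walk , _ = connected root v (v≢root ∘ sym) in within-walk {0} I refl walk

  distance : Fin (n G) → ℕ
  distance v = proj₁ (leastWitness (λ k → within? k v) (proj₂ (reachable v)))

  distance-least : ∀ v → IsLeast (λ k → Within k v) (distance v)
  distance-least v = proj₂ (leastWitness (λ k → within? k v) (proj₂ (reachable v)))

  distance-zero : ∀ {v} → distance v ≡ 0 → v ≡ root
  distance-zero {v} d≡0 = subst (λ k → Within k v) d≡0 (proj₁ (distance-least v))

  distance-parent : ∀ {v k} → distance v ≡ suc k → ∃ λ u → Adj G u v × distance u ≡ k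
  distance-parent {v} {k} d≡k+1 with subst (λ j → Within j v) d≡k+1 (proj₁ (distance-least v))
  ... | inj₁ within-k = ⊥-elim (proj₂ (distance-least v) k (subst (k <_) (sym d≡k+1) ≤-refl) within-k)
  ... | inj₂ (u , within-k , a) = u , a , ≤-antisym du≤k k≤du
    where
    du≤k : distance u ≤ k
    du≤k = ≮⇒≥ λ k<du → proj₂ (distance-least u) k k<du within-k
    k≤du : k ≤ distance u
    k≤du = ≮⇒≥ λ du<k → proj₂ (distance-least v) (suc (distance u))
                          (subst (suc (distance u) <_) (sym d≡k+1) (s≤s du<k))
                          (inj₂ (u , proj₁ (distance-least u) , a))

  colour : Fin (n G) → Bool
  colour v = parity (distance v)

  toRoot : ∀ k v → distance v ≡ k → Star (Bichromatic G colour) v root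
  toRoot zero    v d≡0   = subst (λ x → Star _ x root) (sym (distance-zero d≡0)) ε
  toRoot (suc k) v d≡k+1 with distance-parent d≡k+1
  ... | u , a , du≡k = (adj-symmetric G a , differ) ◅ toRoot k u du≡k
    where
    differ : colour v ≢ colour u
    differ same = not-¬ refl (sym (trans (cong parity (sym d≡k+1)) (trans same (cong parity du≡k))))

  bichromaticallyConnected : BichromaticallyConnected G colour
  bichromaticallyConnected u v =
    toRoot _ u refl ◅◅ Star.reverse (bichromatic-sym {G}) (toRoot _ v refl)

-- Cartesian products

record IsCartesianProduct (V G H : Graph) : Set where
  field
    pair         : Fin (n G) → Fin (n H) → Fin (n V)
    fst          : Fin (n V) → Fin (n G)
    snd          : Fin (n V) → Fin (n H)
    fst-pair     : ∀ g h → fst (pair g h) ≡ g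
    snd-pair     : ∀ g h → snd (pair g h) ≡ h
    pair-fst-snd : ∀ x → pair (fst x) (snd x) ≡ x
    adj-pairˡ    : ∀ {g g′} h → Adj G g g′ → Adj V (pair g h) (pair g′ h)
    adj-pairʳ    : ∀ g {h h′} → Adj H h h′ → Adj V (pair g h) (pair g h′)
    adj-cases    : ∀ {x y} → Adj V x y →
                   (fst x ≡ fst y × Adj H (snd x) (snd y)) ⊎ (snd x ≡ snd y × Adj G (fst x) (fst y))

  pair-injective : ∀ {g g′ h h′} → pair g h ≡ pair g′ h′ → g ≡ g′ × h ≡ h′
  pair-injective {g} {g′} {h} {h′} e =
    trans (sym (fst-pair g h)) (trans (cong fst e) (fst-pair g′ h′)) ,
    trans (sym (snd-pair g h)) (trans (cong snd e) (snd-pair g′ h′))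

  pair-≢ˡ : ∀ {g g′ h h′} → g ≢ g′ → pair g h ≢ pair g′ h′
  pair-≢ˡ g≢g′ = g≢g′ ∘ proj₁ ∘ pair-injective

  pair-≢ʳ : ∀ {g g′ h h′} → h ≢ h′ → pair g h ≢ pair g′ h′
  pair-≢ʳ h≢h′ = h≢h′ ∘ proj₂ ∘ pair-injective

  pair-coordinates : ∀ {z g h} → fst z ≡ g → snd z ≡ h → z ≡ pair g h
  pair-coordinates {z} refl refl = sym (pair-fst-snd z)

  ¬adj-diagonal : ∀ {g g′ h h′} → g ≢ g′ → h ≢ h′ → ¬ Adj V (pair g h) (pair g′ h′)
  ¬adj-diagonal g≢g′ h≢h′ a with adj-cases a
  ... | inj₁ (same , _) = g≢g′ (trans (sym (fst-pair _ _)) (trans same (fst-pair _ _)))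
  ... | inj₂ (same , _) = h≢h′ (trans (sym (snd-pair _ _)) (trans same (snd-pair _ _)))

  corners : ∀ {g g′ h h′ z} → g ≢ g′ → h ≢ h′ → snd z ≡ h ⊎ fst z ≡ g′ → fst z ≡ g ⊎ snd z ≡ h′ →
            z ≡ pair g h ⊎ z ≡ pair g′ h′
  corners _    _    (inj₁ z-h)  (inj₁ z-g)  = inj₁ (pair-coordinates z-g z-h)
  corners _    h≢h′ (inj₁ z-h)  (inj₂ z-h′) = ⊥-elim (h≢h′ (trans (sym z-h) z-h′))
  corners g≢g′ _    (inj₂ z-g′) (inj₁ z-g)  = ⊥-elim (g≢g′ (trans (sym z-g) z-g′))
  corners _    _    (inj₂ z-g′) (inj₂ z-h′) = inj₂ (pair-coordinates z-g′ z-h′)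

  map-pairˡ-fst : ∀ g hs → All (λ z → fst z ≡ g) (map (pair g) hs)
  map-pairˡ-fst g hs = All.map⁺ (All.universal (fst-pair g) hs)

  map-pairʳ-snd : ∀ h gs → All (λ z → snd z ≡ h) (map (λ g → pair g h) gs)
  map-pairʳ-snd h gs = All.map⁺ (All.universal (λ g → snd-pair g h) gs)

  pair-cases : {Q : Fin (n V) → Fin (n V) → Set} →
               (∀ g {h h′} → h ≢ h′ → Q (pair g h) (pair g h′)) →
               (∀ {g g′} h → g ≢ g′ → Q (pair g h) (pair g′ h)) →
               (∀ {g g′ h h′} → g ≢ g′ → h ≢ h′ → Q (pair g h) (pair g′ h′)) →
               ∀ x y → x ≢ y → Q x y
  pair-cases {Q} sameˡ sameʳ differ x y x≢y =
    subst₂ Q (pair-fst-snd x) (pair-fst-snd y) (cases (fst x) (snd x) (fst y) (snd y) coordinates-differ)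
    where
    coordinates-differ : pair (fst x) (snd x) ≢ pair (fst y) (snd y)
    coordinates-differ e = x≢y (trans (sym (pair-fst-snd x)) (trans e (pair-fst-snd y)))
    cases : ∀ g h g′ h′ → pair g h ≢ pair g′ h′ → Q (pair g h) (pair g′ h′)
    cases g h g′ h′ ne with g ≟ g′ | h ≟ h′
    ... | yes refl | yes refl = ⊥-elim (ne refl)
    ... | yes refl | no  h≢h′ = sameˡ g h≢h′
    ... | no  g≢g′ | yes refl = sameʳ h g≢g′
    ... | no  g≢g′ | no  h≢h′ = differ g≢g′ h≢h′

swap : ∀ {V G H} → IsCartesianProduct V G H → IsCartesianProduct V H G
swap P = record
  { pair         = λ h g → pair g h
  ; fst          = snd
  ; snd          = fst
  ; fst-pair     = λ h g → snd-pair g h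
  ; snd-pair     = λ h g → fst-pair g h
  ; pair-fst-snd = pair-fst-snd
  ; adj-pairˡ    = λ g a → adj-pairʳ g a
  ; adj-pairʳ    = λ h a → adj-pairˡ h a
  ; adj-cases    = Sum.swap ∘ adj-cases
  }
  where open IsCartesianProduct P

module _ (G H : Graph) where

  private
    -- Definitionally the (private) adjacency of G □ H in Defs, applied to remQuot of the two vertices.
    adjacent : Fin (n G) × Fin (n H) → Fin (n G) × Fin (n H) → Bool
    adjacent (g , h) (g′ , h′) = (⌊ g ≟ g′ ⌋ ∧ adj H h h′) ∨ (⌊ h ≟ h′ ⌋ ∧ adj G g g′)

    adjacent-cases : ∀ g h g′ h′ → adjacent (g , h) (g′ , h′) ≡ true →
                     (g ≡ g′ × Adj H h h′) ⊎ (h ≡ h′ × Adj G g g′)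
    adjacent-cases g h g′ h′ e =
      Sum.map (witnesses (g ≟ g′) (adj H h h′)) (witnesses (h ≟ h′) (adj G g g′))
                   (Equivalence.to T-∨ (Equivalence.from T-≡ e))
      where
      witnesses : ∀ {P : Set} (p? : Dec P) b → T (⌊ p? ⌋ ∧ b) → P × b ≡ true
      witnesses p? b t = let tp , tb = Equivalence.to T-∧ t in toWitness tp , Equivalence.to T-≡ tb

    adjacentˡ : ∀ {g g′} h → Adj G g g′ → adjacent (g , h) (g′ , h) ≡ true
    adjacentˡ h a with h ≟ h
    ... | yes _   rewrite a = ∨-zeroʳ _
    ... | no  h≢h = ⊥-elim (h≢h refl)

    adjacentʳ : ∀ g {h h′} → Adj H h h′ → adjacent (g , h) (g , h′) ≡ true
    adjacentʳ g a with g ≟ g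
    ... | yes _   rewrite a = refl
    ... | no  g≢g = ⊥-elim (g≢g refl)

  □-isCartesianProduct : IsCartesianProduct (G □ H) G H
  □-isCartesianProduct = record
    { pair         = combine
    ; fst          = proj₁ ∘ remQuot {n G} (n H)
    ; snd          = proj₂ ∘ remQuot {n G} (n H)
    ; fst-pair     = λ g h → cong proj₁ (remQuot-combine g h)
    ; snd-pair     = λ g h → cong proj₂ (remQuot-combine g h)
    ; pair-fst-snd = combine-remQuot {n G} (n H)
    ; adj-pairˡ    = λ {g} {g′} h a →
        trans (cong₂ adjacent (remQuot-combine g h) (remQuot-combine g′ h)) (adjacentˡ h a)
    ; adj-pairʳ    = λ g {h} {h′} a →
        trans (cong₂ adjacent (remQuot-combine g h) (remQuot-combine g h′)) (adjacentʳ g a)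
    ; adj-cases    = λ {x} {y} e → let g , h = remQuot {n G} (n H) x ; g′ , h′ = remQuot {n G} (n H) y in
        adjacent-cases g h g′ h′ e
    }

module ProductWalks {V G H : Graph} (P : IsCartesianProduct V G H) where

  open IsCartesianProduct P

  project : ∀ {x y} (w : Star (Adj V) x y) →
            Σ (Star (Adj G) (fst x) (fst y)) λ wG → Σ (Star (Adj H) (snd x) (snd y)) λ wH →
            steps wG + steps wH ≡ steps w
  project ε = ε , ε , refl
  project (a ◅ w) with project w | adj-cases a
  ... | wG , wH , total | inj₁ (same , aH) =
    let wG′ , wG′-steps = relabel (sym same) refl wG in
    wG′ , aH ◅ wH , trans (cong (_+ suc (steps wH)) wG′-steps) (trans (+-suc _ _) (cong suc total))
  ... | wG , wH , total | inj₂ (same , aG) =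
    let wH′ , wH′-steps = relabel (sym same) refl wH in
    aG ◅ wG , wH′ , cong suc (trans (cong (steps wG +_) wH′-steps) total)

  path-split : ∀ {g g′ h h′} zs → IsPath V (pair g h) (pair g′ h′) zs →
               Σ (Star (Adj G) g g′) λ wG → Σ (Star (Adj H) h h′) λ wH → steps wG + steps wH ≡ suc (length zs)
  path-split {g} {g′} {h} {h′} zs (walk , _) =
    let w , w-steps = walk⇒star zs walk
        wG , wH , total = project w
        wG′ , wG′-steps = relabel (fst-pair g h) (fst-pair g′ h′) wG
        wH′ , wH′-steps = relabel (snd-pair g h) (snd-pair g′ h′) wH
    in wG′ , wH′ , trans (cong₂ _+_ wG′-steps wH′-steps) (trans total w-steps)

  path-length-≥ : ∀ {g g′ h h′ i j} → (∀ (wG : Star (Adj G) g g′) → i ≤ steps wG) →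
                  (∀ (wH : Star (Adj H) h h′) → j ≤ steps wH) →
                  ∀ zs → IsPath V (pair g h) (pair g′ h′) zs → i + j ≤ suc (length zs)
  path-length-≥ {i = i} {j} boundG boundH zs path =
    let wG , wH , total = path-split zs path in
    subst (i + j ≤_) total (+-mono-≤ (boundG wG) (boundH wH))

  distant-path-length : ∀ {g g′ h h′} → g ≢ g′ → ¬ Adj G g g′ → h ≢ h′ →
                        ∀ zs → IsPath V (pair g h) (pair g′ h′) zs → 2 ≤ length zs
  distant-path-length g≢g′ ¬adj h≢h′ zs path =
    s≤s⁻¹ (path-length-≥ (steps-≥2 g≢g′ ¬adj) (steps-≥1 h≢h′) zs path)

  no-two-step-walk : n G ≤ 2 → ∀ {g g′ h} → g ≢ g′ →
                     (wG : Star (Adj G) g g′) (wH : Star (Adj H) h h) → steps wG + steps wH ≢ 2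
  no-two-step-walk _     g≢g′ ε             _             _ = g≢g′ refl
  no-two-step-walk _     _    (_ ◅ ε)       (loop ◅ ε)    _ = adj-irreflexive H loop
  no-two-step-walk small g≢g′ (a ◅ a′ ◅ ε)  ε             _ =
    no-three-distinct small (adj⇒≢ G a) g≢g′ (adj⇒≢ G a′)
  no-two-step-walk _     _    (_ ◅ ε)       ε             ()
  no-two-step-walk _     _    (_ ◅ ε)       (_ ◅ _ ◅ _)   ()
  no-two-step-walk _     _    (_ ◅ _ ◅ ε)   (_ ◅ _)       ()
  no-two-step-walk _     _    (_ ◅ _ ◅ _ ◅ _) _           ()

  short-path-is-edge : n G ≤ 2 → ∀ {g g′ h} → g ≢ g′ →
                       ∀ zs → IsPath V (pair g h) (pair g′ h) zs → length zs ≤ 1 → zs ≡ []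
  short-path-is-edge _     _    []          _    _       = refl
  short-path-is-edge small g≢g′ (w ∷ [])    path _       =
    let wG , wH , total = path-split [ w ] path in ⊥-elim (no-two-step-walk small g≢g′ wG wH total)
  short-path-is-edge _     _    (_ ∷ _ ∷ _) _    (s≤s ())

module OneColour {V G H : Graph} (P : IsCartesianProduct V G H) where

  open IsCartesianProduct P
  open ProductWalks P

  distant-pair⇒¬pvc : ∀ {g g′ h h′} → g ≢ g′ → ¬ Adj G g g′ → h ≢ h′ →
                      ∀ {k} (c : Coloring V 1) → ¬ ProperVertexKConnected V (suc k) c
  distant-pair⇒¬pvc g≢g′ ¬adj h≢h′ c pvc =
    let ps , paths , _ = pvc _ _ (pair-≢ˡ g≢g′)
        path , proper = paths zero
    in ≤⇒≯ (vertexProper₁-short {V} c proper) (distant-path-length g≢g′ ¬adj h≢h′ (ps zero) path)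

  small-factor⇒¬pvc₂ : n G ≤ 2 → ∀ {g g′} → g ≢ g′ → Fin (n H) →
                       (c : Coloring V 1) → ¬ ProperVertexKConnected V 2 c
  small-factor⇒¬pvc₂ small {g} {g′} g≢g′ h c pvc =
    let ps , paths , disjoint = pvc (pair g h) (pair g′ h) (pair-≢ˡ g≢g′)
        edge : ∀ i → ps i ≡ []
        edge i = let path , proper = paths i in
                 short-path-is-edge small g≢g′ (ps i) path (vertexProper₁-short {V} c proper)
    in proj₂ (disjoint 0F 1F (λ ())) (edge 0F , edge 1F)

-- Two colours suffice for two disjoint paths

module SameLayer {V G H : Graph} (P : IsCartesianProduct V G H) {k} (c : Coloring V k)
  {RG : Rel (Fin (n G)) 0ℓ} {RH : Rel (Fin (n H)) 0ℓ}
  (spanG : ∀ g g′ → Star RG g g′) (spanH : ∀ h h′ → Star RH h h′)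
  (liftG : ∀ {g g′} h → RG g g′ →
           Bichromatic V c (IsCartesianProduct.pair P g h) (IsCartesianProduct.pair P g′ h))
  (liftH : ∀ g {h h′} → RH h h′ →
           Bichromatic V c (IsCartesianProduct.pair P g h) (IsCartesianProduct.pair P g h′))
  (nontrivialG : Nontrivial G)
  where

  open IsCartesianProduct P

  -- The second path detours through the layer of a neighbour g₁ of g; recording that each of its
  -- edges touches that layer keeps its shortcut from collapsing to the edge between the two ends.
  viaNeighbour : ∀ {g g₁ h h′} IH → Walk RH h IH h′ → RG g g₁ → h ≢ h′ →
                 TwoDisjointProperPaths V c (pair g h) (pair g h′)
  viaNeighbour {g} {g₁} {h} {h′} IH walkH r h≢h′ =
    let p , _      , path-p , in-p = bichromaticPath {V} {c = c} id (map (pair g) IH) ends≢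
                                       (walk-map (pair g) (liftH g) IH walkH) (map-pairˡ-fst g IH)
        q , walk-q , path-q , in-q = bichromaticPath {V} {c = c} proj₁
                                       (map (pair g₁) (h ∷ IH ++ [ h′ ])) ends≢
                                       ((liftG h r , inj₂ (fst-pair g₁ h)) ∷ detour IH walkH)
                                       (map-pairˡ-fst g₁ (h ∷ IH ++ [ h′ ]))
    in p , q , path-p , path-q ,
       (λ z z∈p z∈q → g≢g₁ (trans (sym (All.lookup in-p z∈p)) (All.lookup in-q z∈q))) ,
       (λ (_ , q≡[]) → leaves (subst (λ q → Walk Detour (pair g h) q (pair g h′)) q≡[] walk-q))
    where
    ends≢ : pair g h ≢ pair g h′
    ends≢ = pair-≢ʳ h≢h′

    g≢g₁ : g ≢ g₁
    g≢g₁ g≡g₁ = adj⇒≢ V (proj₁ (liftG h r)) (cong (λ x → pair x h) g≡g₁)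

    Detour : Rel (Fin (n V)) 0ℓ
    Detour x y = Bichromatic V c x y × (fst x ≡ g₁ ⊎ fst y ≡ g₁)

    detour : ∀ {h} I → Walk RH h I h′ → Linked Detour (map (pair g₁) (h ∷ I ++ [ h′ ]) ++ [ pair g h′ ])
    detour []      (r′ ∷ [-]) = (liftH g₁ r′ , inj₁ (fst-pair g₁ _)) ∷
                                (bichromatic-sym {V} {c = c} (liftG h′ r) , inj₁ (fst-pair g₁ h′)) ∷ [-]
    detour (_ ∷ I) (r′ ∷ w)   = (liftH g₁ r′ , inj₁ (fst-pair g₁ _)) ∷ detour I w

    leaves : ¬ Walk Detour (pair g h) [] (pair g h′)
    leaves ((_ , inj₁ e) ∷ _) = g≢g₁ (trans (sym (fst-pair g h)) e)
    leaves ((_ , inj₂ e) ∷ _) = g≢g₁ (trans (sym (fst-pair g h′)) e)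

  sameLayer : ∀ g {h h′} → h ≢ h′ → TwoDisjointProperPaths V c (pair g h) (pair g h′)
  sameLayer g {h} {h′} h≢h′ =
    let g* , g*≢g       = anotherVertex nontrivialG g
        g₁ , r          = firstStep (g*≢g ∘ sym) (spanG g g*)
        IH , walkH , _  = star⇒walk (spanH h h′) h≢h′
    in viaNeighbour IH walkH r h≢h′

module DisjointPaths {V G H : Graph} (P : IsCartesianProduct V G H) {k} (c : Coloring V k)
  {RG : Rel (Fin (n G)) 0ℓ} {RH : Rel (Fin (n H)) 0ℓ}
  (spanG : ∀ g g′ → Star RG g g′) (spanH : ∀ h h′ → Star RH h h′)
  (liftG : ∀ {g g′} h → RG g g′ →
           Bichromatic V c (IsCartesianProduct.pair P g h) (IsCartesianProduct.pair P g′ h))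
  (liftH : ∀ g {h h′} → RH h h′ →
           Bichromatic V c (IsCartesianProduct.pair P g h) (IsCartesianProduct.pair P g h′))
  (nontrivialG : Nontrivial G) (nontrivialH : Nontrivial H)
  where

  open IsCartesianProduct P

  crossing : ∀ {g g′ h h′} → g ≢ g′ → h ≢ h′ → TwoDisjointProperPaths V c (pair g h) (pair g′ h′)
  crossing {g} {g′} {h} {h′} g≢g′ h≢h′ =
    let IG , walkG , _ = star⇒walk (spanG g g′) g≢g′
        IH , walkH , _ = star⇒walk (spanH h h′) h≢h′
        rowG : ∀ h → Walk (Bichromatic V c) (pair g h) (map (λ x → pair x h) IG) (pair g′ h)
        rowG h = walk-map (λ x → pair x h) (liftG h) IG walkG
        columnH : ∀ g → Walk (Bichromatic V c) (pair g h) (map (pair g) IH) (pair g h′)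
        columnH g = walk-map (pair g) (liftH g) IH walkH
        p , walk-p , path-p , in-p =
          bichromaticPath {V} {c = c} id (map (λ x → pair x h) IG ++ pair g′ h ∷ map (pair g′) IH) ends≢
            (walk-++ (map (λ x → pair x h) IG) (rowG h) (columnH g′))
            (All.++⁺ (All.map inj₁ (map-pairʳ-snd h IG))
                     (inj₁ (snd-pair g′ h) ∷ All.map inj₂ (map-pairˡ-fst g′ IH)))
        q , _ , path-q , in-q =
          bichromaticPath {V} {c = c} id (map (pair g) IH ++ pair g h′ ∷ map (λ x → pair x h′) IG) ends≢
            (walk-++ (map (pair g) IH) (columnH g) (rowG h′))
            (All.++⁺ (All.map inj₁ (map-pairˡ-fst g IH))
                     (inj₂ (snd-pair g h′) ∷ All.map inj₂ (map-pairʳ-snd h′ IG)))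
    in p , q , path-p , path-q ,
       (λ z z∈p z∈q → let z≢x , z≢y = unique-avoids-ends p (proj₂ (proj₁ path-p)) z∈p in
                      Sum.[ z≢x , z≢y ]
                        (corners g≢g′ h≢h′ (All.lookup in-p z∈p) (All.lookup in-q z∈q))) ,
       (λ (p≡[] , _) → ¬adj-diagonal g≢g′ h≢h′ (proj₁ (Linked.head
                         (subst (λ p → Walk (Bichromatic V c) (pair g h) p (pair g′ h′)) p≡[] walk-p))))
    where
    ends≢ : pair g h ≢ pair g′ h′
    ends≢ = pair-≢ˡ g≢g′

  twoDisjointPaths : ∀ x y → x ≢ y → TwoDisjointProperPaths V c x y
  twoDisjointPaths = pair-cases (Layer.sameLayer) (λ h → Swapped.sameLayer h) crossing
    where
    module Layer   = SameLayer P c spanG spanH liftG liftH nontrivialG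
    module Swapped = SameLayer (swap P) c spanH spanG (λ g → liftH g) (λ h → liftG h) nontrivialH

module XorColouring {V G H : Graph} (P : IsCartesianProduct V G H)
  (cG : Fin (n G) → Bool) (cH : Fin (n H) → Bool)
  where

  open IsCartesianProduct P

  colour : Coloring V 2
  colour x = Inverse.from 2↔Bool (cG (fst x) xor cH (snd x))

  private
    colour-≢ : ∀ {x y} → cG (fst x) xor cH (snd x) ≢ cG (fst y) xor cH (snd y) → colour x ≢ colour y
    colour-≢ differ same = differ (trans (sym (Inverse.strictlyInverseˡ 2↔Bool _))
                                 (trans (cong (Inverse.to 2↔Bool) same) (Inverse.strictlyInverseˡ 2↔Bool _)))

  liftG : ∀ {g g′} h → Bichromatic G cG g g′ → Bichromatic V colour (pair g h) (pair g′ h)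
  liftG {g} {g′} h (a , differ) = adj-pairˡ h a , colour-≢ distinct
    where
    distinct : cG (fst (pair g h)) xor cH (snd (pair g h)) ≢ cG (fst (pair g′ h)) xor cH (snd (pair g′ h))
    distinct rewrite fst-pair g h | snd-pair g h | fst-pair g′ h | snd-pair g′ h = xor-≢ˡ (cH h) differ

  liftH : ∀ g {h h′} → Bichromatic H cH h h′ → Bichromatic V colour (pair g h) (pair g h′)
  liftH g {h} {h′} (a , differ) = adj-pairʳ g a , colour-≢ distinct
    where
    distinct : cG (fst (pair g h)) xor cH (snd (pair g h)) ≢ cG (fst (pair g h′)) xor cH (snd (pair g h′))
    distinct rewrite fst-pair g h | snd-pair g h | fst-pair g h′ | snd-pair g h′ = xor-≢ʳ (cG g) differ

connected-pvc₂ : ∀ {V G H} → IsCartesianProduct V G H →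
                 Nontrivial G → Nontrivial H → Connected G → Connected H →
                 Σ (Coloring V 2) (ProperVertexKConnected V 2)
connected-pvc₂ {V} {G} {H} P nontrivialG nontrivialH connectedG connectedH =
  colour , twoPaths⇒pvc₂ {V} (DisjointPaths.twoDisjointPaths P colour
                                BG.bichromaticallyConnected BH.bichromaticallyConnected
                                liftG liftH nontrivialG nontrivialH)
  where
  module BG = BreadthFirst G connectedG (vertex nontrivialG)
  module BH = BreadthFirst H connectedH (vertex nontrivialH)
  open XorColouring P BG.colour BH.colour

-- Products of complete graphs

module CompleteProduct {V G H : Graph} (P : IsCartesianProduct V G H)
  (completeG : Complete G) (completeH : Complete H)
  where

  open IsCartesianProduct P

  adj-layerˡ : ∀ {g g′} h → g ≢ g′ → Adj V (pair g h) (pair g′ h)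
  adj-layerˡ h g≢g′ = adj-pairˡ h (completeG _ _ g≢g′)

  adj-layerʳ : ∀ g {h h′} → h ≢ h′ → Adj V (pair g h) (pair g h′)
  adj-layerʳ g h≢h′ = adj-pairʳ g (completeH _ _ h≢h′)

  diagonal-path : ∀ {g g′ h h′} → g ≢ g′ → h ≢ h′ → IsPath V (pair g h) (pair g′ h′) [ pair g′ h ]
  diagonal-path g≢g′ h≢h′ = two-edge-path V (adj-layerˡ _ g≢g′) (adj-layerʳ _ h≢h′) (pair-≢ˡ g≢g′)

  spvc : StrongProperVertexConnected V (monochrome V)
  spvc = pair-cases
    (λ g h≢h′ → [] , (edge-path V (adj-layerʳ g h≢h′) , λ _ _ → z≤n) , [])
    (λ h g≢g′ → [] , (edge-path V (adj-layerˡ h g≢g′) , λ _ _ → z≤n) , [])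
    (λ g≢g′ h≢h′ → [ _ ] , (diagonal-path g≢g′ h≢h′ , nonadjacent g≢g′ h≢h′) , [-])
    where
    nonadjacent : ∀ {g g′ h h′} → g ≢ g′ → h ≢ h′ → ∀ ys → IsPath V (pair g h) (pair g′ h′) ys → 1 ≤ length ys
    nonadjacent g≢g′ h≢h′ []      (a ∷ _ , _) = ⊥-elim (¬adj-diagonal g≢g′ h≢h′ a)
    nonadjacent _    _    (_ ∷ _) _           = s≤s z≤n

  sameLayer : 3 ≤ n H → ∀ g {h h′} → h ≢ h′ → TwoDisjointProperPaths V (monochrome V) (pair g h) (pair g h′)
  sameLayer bigH g h≢h′ =
    let h″ , h″≢h , h″≢h′ = thirdVertex bigH h≢h′ in
    [] , [ pair g h″ ] ,
    (edge-path V (adj-layerʳ g h≢h′) , []) ,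
    (two-edge-path V (adj-layerʳ g (h″≢h ∘ sym)) (adj-layerʳ g h″≢h′) (pair-≢ʳ h≢h′) , [-]) ,
    (λ _ ()) , λ { (_ , ()) }

  crossing : ∀ {g g′ h h′} → g ≢ g′ → h ≢ h′ → TwoDisjointProperPaths V (monochrome V) (pair g h) (pair g′ h′)
  crossing g≢g′ h≢h′ =
    [ _ ] , [ _ ] ,
    (diagonal-path g≢g′ h≢h′ , [-]) ,
    (two-edge-path V (adj-layerʳ _ h≢h′) (adj-layerˡ _ g≢g′) (pair-≢ˡ g≢g′) , [-]) ,
    (λ { _ (here refl) (here same) → g≢g′ (sym (proj₁ (pair-injective same))) }) , λ { (() , _) }

complete-pvc₂ : ∀ {V G H} (P : IsCartesianProduct V G H) (completeG : Complete G) (completeH : Complete H) →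
                3 ≤ n G → 3 ≤ n H → ProperVertexKConnected V 2 (monochrome V)
complete-pvc₂ {V} P completeG completeH bigG bigH =
  twoPaths⇒pvc₂ {V} (pair-cases (sameLayer bigH) (λ h → Swapped.sameLayer bigG h) crossing)
  where
  open IsCartesianProduct P
  open CompleteProduct P completeG completeH
  module Swapped = CompleteProduct (swap P) completeH completeG

-- Geodesics in products

module ProductGeodesics {V G H : Graph} (P : IsCartesianProduct V G H)
  {s} (cG : Coloring G s) (spvcG : StrongProperVertexConnected G cG)
  (geodesicsH : ∀ h h′ → h ≢ h′ → ∃ (IsGeodesic H h h′))
  {χ} (cH : Coloring H χ) (properH : ProperColoring H cH)
  where

  open IsCartesianProduct P
  open ProductWalks P

  colour : Coloring V (s * χ)
  colour x = combine (cG (fst x)) (cH (snd x))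

  private
    Differ : Rel (Fin (n V)) 0ℓ
    Differ x y = colour x ≢ colour y

    colour-injective : ∀ {x y} → colour x ≡ colour y → cG (fst x) ≡ cG (fst y) × cH (snd x) ≡ cH (snd y)
    colour-injective {x} {y} = combine-injective (cG (fst x)) (cH (snd x)) (cG (fst y)) (cH (snd y))

    differˡ : ∀ {g g′} h → cG g ≢ cG g′ → Differ (pair g h) (pair g′ h)
    differˡ {g} {g′} h differ same =
      differ (subst₂ (λ a b → cG a ≡ cG b) (fst-pair g h) (fst-pair g′ h) (proj₁ (colour-injective same)))

    differʳ : ∀ g {h h′} → Adj H h h′ → Differ (pair g h) (pair g h′)
    differʳ g {h} {h′} a same =
      properH h h′ a
        (subst₂ (λ a b → cH a ≡ cH b) (snd-pair g h) (snd-pair g h′) (proj₂ (colour-injective same)))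

    shortest-via : ∀ {g g′ h h′ i j} (I : List (Fin (n V))) → (∀ (wG : Star (Adj G) g g′) → i ≤ steps wG) →
                   (∀ (wH : Star (Adj H) h h′) → j ≤ steps wH) → suc (length I) ≡ i + j →
                   ∀ zs → IsPath V (pair g h) (pair g′ h′) zs → length I ≤ length zs
    shortest-via I boundG boundH length-I zs path =
      s≤s⁻¹ (subst (_≤ suc (length zs)) (sym length-I) (path-length-≥ boundG boundH zs path))

    Geodesic : Fin (n V) → Fin (n V) → Set
    Geodesic x y = ∃ λ p → IsGeodesic V x y p × VertexProper {V} colour p

    sameˡ : ∀ g {h h′} → h ≢ h′ → Geodesic (pair g h) (pair g h′)
    sameˡ g h≢h′ =
      let ys , geodesic@((walkH , _) , _) = geodesicsH _ _ h≢h′ in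
      shortest-walk⇒geodesic {V} {c = colour} (map (pair g) ys) (pair-≢ʳ h≢h′)
        (walk-map (pair g) (adj-pairʳ g) ys walkH)
        (Linked.map⁺ (Linked.map (differʳ g) (walk-interior ys walkH)))
        (shortest-via (map (pair g) ys) (λ _ → z≤n) (geodesic-≤-steps H ys geodesic)
          (cong suc (length-map (pair g) ys)))

    sameʳ : ∀ {g g′} h → g ≢ g′ → Geodesic (pair g h) (pair g′ h)
    sameʳ h g≢g′ =
      let xs , geodesic@((walkG , _) , _) , properG = spvcG _ _ g≢g′ in
      shortest-walk⇒geodesic {V} {c = colour} (map (λ x → pair x h) xs) (pair-≢ˡ g≢g′)
        (walk-map (λ x → pair x h) (adj-pairˡ h) xs walkG)
        (Linked.map⁺ (Linked.map (differˡ h) properG))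
        (shortest-via (map (λ x → pair x h) xs) (geodesic-≤-steps G xs geodesic) (λ _ → z≤n)
          (trans (cong suc (length-map (λ x → pair x h) xs)) (sym (+-identityʳ _))))

    -- One step along a proper geodesic of G, a geodesic of H inside that layer, then the rest of the
    -- G-geodesic: internal neighbours differ in their H-colour on the H-part and in their G-colour on
    -- the G-part, and the length d_G + d_H is the distance in G □ H.
    diagonal : ∀ {g g′ h h′} → g ≢ g′ → h ≢ h′ → Geodesic (pair g h) (pair g′ h′)
    diagonal {g} {g′} {h} {h′} g≢g′ h≢h′ with spvcG g g′ g≢g′ | geodesicsH h h′ h≢h′
    ... | [] , geodesicG@((a ∷ [-] , _) , _) , _ | ys , geodesicH@((walkH , _) , _) =
      shortest-walk⇒geodesic {V} {c = colour} (pair g′ h ∷ map (pair g′) ys) (pair-≢ˡ g≢g′)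
        (adj-pairˡ h a ∷ walk-map (pair g′) (adj-pairʳ g′) ys walkH)
        (Linked.map⁺ (Linked.map (differʳ g′) (walk-init ys walkH)))
        (shortest-via (pair g′ h ∷ map (pair g′) ys)
          (geodesic-≤-steps G [] geodesicG) (geodesic-≤-steps H ys geodesicH)
          (cong (λ l → suc (suc l)) (length-map (pair g′) ys)))
    ... | x₁ ∷ rest , geodesicG@((a ∷ walkG , _) , _) , properG | ys , geodesicH@((walkH , _) , _) =
      shortest-walk⇒geodesic {V} {c = colour} (column ++ pair x₁ h′ ∷ row) (pair-≢ˡ g≢g′)
        (walk-++ column (adj-pairˡ h a ∷ walk-map (pair x₁) (adj-pairʳ x₁) ys walkH)
                        (walk-map (λ x → pair x h′) (adj-pairˡ h′) rest walkG))
        (linked-join column (walk-map (pair x₁) (differʳ x₁) ys walkH)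
                            (Linked.map⁺ (Linked.map (differˡ h′) properG)))
        (shortest-via (column ++ pair x₁ h′ ∷ row)
          (geodesic-≤-steps G (x₁ ∷ rest) geodesicG) (geodesic-≤-steps H ys geodesicH) length-I)
      where
      open ≡-Reasoning
      column row : List (Fin (n V))
      column = pair x₁ h ∷ map (pair x₁) ys
      row    = map (λ x → pair x h′) rest
      length-I : suc (length (column ++ pair x₁ h′ ∷ row)) ≡ suc (length (x₁ ∷ rest)) + suc (length ys)
      length-I = cong suc (begin
        length (column ++ pair x₁ h′ ∷ row)                 ≡⟨ length-++ column ⟩
        suc (length (map (pair x₁) ys)) + suc (length row)  ≡⟨ cong₂ (λ a b → suc a + suc b)
                                                                     (length-map _ ys) (length-map _ rest) ⟩
        suc (length ys) + suc (length rest)                 ≡⟨ +-comm (suc (length ys)) _ ⟩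
        suc (length rest) + suc (length ys)                 ∎)

  spvc : StrongProperVertexConnected V colour
  spvc = pair-cases sameˡ sameʳ diagonal

product-spvc-≤ : ∀ {V G H} → IsCartesianProduct V G H → ∀ {s sG sH χH} →
                 IsSpvc V s → IsSpvc G sG → IsSpvc H sH → IsChromatic H χH → s ≤ sG * χH
product-spvc-≤ {H = H} P spvc-s ((cG , spvcG) , _) ((_ , spvcH) , _) ((cH , properH) , _) =
  isLeast⇒≤ spvc-s (colour , spvc)
  where open ProductGeodesics P cG spvcG (spvc⇒geodesics {H} spvcH) cH properH

module BoxProduct (G H : Graph) (nontrivialG : Nontrivial G) (nontrivialH : Nontrivial H) where

  P : IsCartesianProduct (G □ H) G H
  P = □-isCartesianProduct G H

  open IsCartesianProduct P

  no-colouring₀ : ∀ {Q : Coloring (G □ H) 0 → Set} → ¬ Σ (Coloring (G □ H) 0) Q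
  no-colouring₀ (c , _) with c (pair (vertex nontrivialG) (vertex nontrivialH))
  ... | ()

  ¬complete⇒¬pvc : ¬ (Complete G × Complete H) →
                   ∀ {k} (c : Coloring (G □ H) 1) → ¬ ProperVertexKConnected (G □ H) (suc k) c
  ¬complete⇒¬pvc ¬complete with complete? G | complete? H
  ... | yes completeG | yes completeH = ⊥-elim (¬complete (completeG , completeH))
  ... | no ¬completeG | _ =
    let g , g′ , g≢g′ , ¬adj = ¬complete⇒nonadjacent G ¬completeG
        h , h′ , h≢h′        = twoVertices nontrivialH
    in OneColour.distant-pair⇒¬pvc P g≢g′ ¬adj h≢h′
  ... | yes _ | no ¬completeH =
    let h , h′ , h≢h′ , ¬adj = ¬complete⇒nonadjacent H ¬completeH
        g , g′ , g≢g′        = twoVertices nontrivialG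
    in OneColour.distant-pair⇒¬pvc (swap P) h≢h′ ¬adj g≢g′

  small⇒¬pvc₂ : ¬ (3 ≤ n G) ⊎ ¬ (3 ≤ n H) → (c : Coloring (G □ H) 1) → ¬ ProperVertexKConnected (G □ H) 2 c
  small⇒¬pvc₂ (inj₁ ¬bigG) =
    let _ , _ , g≢g′ = twoVertices nontrivialG in
    OneColour.small-factor⇒¬pvc₂ P (s≤s⁻¹ (≰⇒> ¬bigG)) g≢g′ (vertex nontrivialH)
  small⇒¬pvc₂ (inj₂ ¬bigH) =
    let _ , _ , h≢h′ = twoVertices nontrivialH in
    OneColour.small-factor⇒¬pvc₂ (swap P) (s≤s⁻¹ (≰⇒> ¬bigH)) h≢h′ (vertex nontrivialG)

  ¬completeBig⇒¬pvc₂ : ¬ (Complete G × Complete H × 3 ≤ n G × 3 ≤ n H) →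
                       (c : Coloring (G □ H) 1) → ¬ ProperVertexKConnected (G □ H) 2 c
  ¬completeBig⇒¬pvc₂ ¬completeBig with complete? G ×-dec complete? H | 3 ≤? n G | 3 ≤? n H
  ... | no ¬complete | _ | _ = ¬complete⇒¬pvc ¬complete
  ... | yes _ | no ¬bigG | _ = small⇒¬pvc₂ (inj₁ ¬bigG)
  ... | yes _ | yes _ | no ¬bigH = small⇒¬pvc₂ (inj₂ ¬bigH)
  ... | yes (completeG , completeH) | yes bigG | yes bigH =
    ⊥-elim (¬completeBig (completeG , completeH , bigG , bigH))

  pvc₁-complete : Complete G × Complete H → IsPvc 1 (G □ H) 1
  pvc₁-complete (completeG , completeH) = isLeast₁ (monochrome (G □ H) , spvc⇒pvc₁ {G □ H} spvc) no-colouring₀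
    where open CompleteProduct P completeG completeH

  pvc₁-¬complete : Connected G → Connected H → ¬ (Complete G × Complete H) → IsPvc 1 (G □ H) 2
  pvc₁-¬complete connectedG connectedH ¬complete =
    let c , pvc₂ = connected-pvc₂ P nontrivialG nontrivialH connectedG connectedH in
    isLeast₂ (c , pvc-mono {G □ H} (s≤s z≤n) pvc₂) no-colouring₀
             (λ (c , pvc) → ¬complete⇒¬pvc ¬complete c pvc)

  pvc₂-completeBig : Complete G × Complete H × 3 ≤ n G × 3 ≤ n H → IsPvc 2 (G □ H) 1
  pvc₂-completeBig (completeG , completeH , bigG , bigH) =
    isLeast₁ (_ , complete-pvc₂ P completeG completeH bigG bigH) no-colouring₀

  pvc₂-¬completeBig : Connected G → Connected H →
                      ¬ (Complete G × Complete H × 3 ≤ n G × 3 ≤ n H) → IsPvc 2 (G □ H) 2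
  pvc₂-¬completeBig connectedG connectedH ¬completeBig =
    isLeast₂ (connected-pvc₂ P nontrivialG nontrivialH connectedG connectedH) no-colouring₀
             (λ (c , pvc) → ¬completeBig⇒¬pvc₂ ¬completeBig c pvc)

  spvc-complete : Complete G × Complete H → IsSpvc (G □ H) 1
  spvc-complete (completeG , completeH) = isLeast₁ (monochrome (G □ H) , spvc) no-colouring₀
    where open CompleteProduct P completeG completeH

  spvc-≤ : ∀ {s sG sH χG χH} → IsSpvc (G □ H) s → IsSpvc G sG → IsSpvc H sH →
           IsChromatic G χG → IsChromatic H χH → s ≤ (sG * χH) ⊓ (sH * χG)
  spvc-≤ spvc-s spvc-sG spvc-sH chromaticG chromaticH =
    ⊓-glb (product-spvc-≤ P spvc-s spvc-sG spvc-sH chromaticH)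
          (product-spvc-≤ (swap P) spvc-s spvc-sH spvc-sG chromaticG)

theorem3p2 : (G H : Graph) →
    Nontrivial G → Nontrivial H → Connected G → Connected H →
    -- (1)
    ((Complete G × Complete H → IsPvc 1 (G □ H) 1) ×
     (¬ (Complete G × Complete H) → IsPvc 1 (G □ H) 2)) ×
    -- (2)
    ((Complete G × Complete H × 3 ≤ n G × 3 ≤ n H → IsPvc 2 (G □ H) 1) ×
     (¬ (Complete G × Complete H × 3 ≤ n G × 3 ≤ n H) → IsPvc 2 (G □ H) 2)) ×
    -- (3)
    ((Complete G × Complete H → IsSpvc (G □ H) 1) ×
     (¬ (Complete G × Complete H) →
        ∀ s sG sH χG χH →
        IsSpvc (G □ H) s → IsSpvc G sG → IsSpvc H sH →
        IsChromatic G χG → IsChromatic H χH →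
        s ≤ (sG * χH) ⊓ (sH * χG)))
theorem3p2 G H nontrivialG nontrivialH connectedG connectedH =
  ( pvc₁-complete
  , pvc₁-¬complete connectedG connectedH )
  , ( pvc₂-completeBig
    , pvc₂-¬completeBig connectedG connectedH )
  , ( spvc-complete
    -- the upper bound holds whether or not the factors are complete
    , λ _ _ _ _ _ _ → spvc-≤ )
  where open BoxProduct G H nontrivialG nontrivialH
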